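{- Consider the budgeted multi-armed bandit problem on tree transition graphs (defined in the context), with budget $B$. Let $\mathsf{Opt}$ be the maximum, over all adaptive strategies making at most $B$ plays, of the expected total reward, and let $\mathsf{LPOpt}$ be the optimal value of the linear program $\mathsf{LP}_{\mathsf{mab}}$ below. Then $\mathsf{LPOpt} \ge \mathsf{Opt}$. $\mathsf{LP}_{\mathsf{mab}}$: variables $z_{u,t}, w_{u,t} \in [0,1]$ for $u \in \mathcal{S}$, $t \in \{1,\dots,B\}$; maximize $\sum_{u,t} r_u z_{u,t}$ subject to (1) $w_{u,t} = z_{\mathrm{parent}(u),t-1}\, p_{\mathrm{parent}(u),u}$ for all $t \in [2,B]$ and all $u \in \mathcal{S}\setminus \bigcup_i\{\rho_i\}$; (2) $\sum_{t'\le t} w_{u,t'} \ge \sum_{t' \le t} z_{u,t'}$ for all $t\in[1,B]$, $u \in \mathcal{S}$; (3) $\sum_{u\in \mathcal{S}} z_{u,t} \le 1$ for all $t \in [1,B]$; (4) $w_{\rho_i,1} = 1$ for all $i \in [1,n]$.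
   Context: Problem (budgeted learning, tree transitions): there are $n$ arms. Arm $i$ has a finite set of states $\mathcal{S}_i$ (the sets $\mathcal{S}_i$ are pairwise disjoint; $\mathcal{S}=\bigcup_i \mathcal{S}_i$), a start state $\rho_i\in\mathcal{S}_i$, and a transition tree $T_i$, a directed out-arborescence on $\mathcal{S}_i$ rooted at $\rho_i$, whose edges $u\to v$ carry probabilities $p_{u,v}>0$ with $\sum_{v:(u,v)\in T_i} p_{u,v}=1$ for every non-leaf $u$. $\mathrm{parent}(u)$ is the parent of $u$ in $T_i$. Each state $u$ has a reward $r_u$ (no martingale condition is assumed). Initially every arm $i$ is in state $\rho_i$. At each time step a strategy may play one arm; playing arm $i$ when it is in state $u$ ("playing state $u$") yields reward $r_u$ and moves arm $i$ to a child $v$ of $u$ with probability $p_{u,v}$, independently of everything else. A strategy is adaptive (its choices may depend on all outcomes observed so far) and may make at most $B$ plays in total; its value is its expected total reward.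
   Formalization: The rewards $r_u$ and the transition probabilities $p_{u,v}$ are rational, and the variables of $\mathsf{LP}_{\mathsf{mab}}$ are taken in ℚ. -}

module Defs where

open import Data.Nat using (ℕ; zero; suc; _∸_)
open import Data.Fin using (Fin; zero; suc)
open import Data.List using (List; []; _∷_; map; concatMap; allFin; foldr)
open import Data.Maybe using (Maybe; just; nothing)
open import Data.Product using (_×_; _,_)
open import Data.Unit using (⊤)
open import Data.Rational using (ℚ; 0ℚ; 1ℚ; _+_; _*_; _≤_; _<_)
open import Data.Vec.Functional using (updateAt)
open import Relation.Binary.PropositionalEquality using (_≡_)

sumFin : (k : ℕ) → (Fin k → ℚ) → ℚ
sumFin zero    f = 0ℚ
sumFin (suc k) f = f zero + sumFin k (λ j → f (suc j))

sumList : List ℚ → ℚ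
sumList = foldr _+_ 0ℚ

sumTo : ℕ → (ℕ → ℚ) → ℚ
sumTo zero    f = 0ℚ
sumTo (suc t) f = sumTo t f + f (suc t)

-- Transition trees of an arm.
-- node r k p cs : a state with reward r, k children cs j, reached with
-- transition probability p j.

data Tree : Set where
  node : ℚ → (k : ℕ) → (Fin k → ℚ) → (Fin k → Tree) → Tree

children# : Tree → ℕ
children# (node r k p cs) = k

rootReward : Tree → ℚ
rootReward (node r k p cs) = r

WF : Tree → Set
WF (node r zero    p cs) = ⊤
WF (node r (suc k) p cs) =
  ((j : Fin (suc k)) → 0ℚ < p j) × (sumFin (suc k) p ≡ 1ℚ) × ((j : Fin (suc k)) → WF (cs j))

-- States of an arm = positions (nodes) of its transition tree.

data Pos : Tree → Set where
  here : ∀ {t} → Pos t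
  into : ∀ {r k p cs} (j : Fin k) → Pos (cs j) → Pos (node r k p cs)

sub : ∀ {t} → Pos t → Tree
sub {t} here   = t
sub (into j π) = sub π

rew : ∀ {t} → Pos t → ℚ
rew π = rootReward (sub π)

extend : ∀ {t} (π : Pos t) → Fin (children# (sub π)) → Pos t
extend {node r k p cs} here j = into j here
extend (into j π) j' = into j (extend π j')

prob : ∀ {t} (π : Pos t) → Fin (children# (sub π)) → ℚ
prob {node r k p cs} here j = p j
prob (into j π) j' = prob π j'

allPos : (t : Tree) → List (Pos t)
allPos (node r k p cs) = here ∷ concatMap (λ j → map (into j) (allPos (cs j))) (allFin k)

sumStates : ∀ {n} (T : Fin n → Tree) → ((i : Fin n) → Pos (T i) → ℚ) → ℚ
sumStates {n} T f = sumFin n (λ i → sumList (map (f i) (allPos (T i))))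

-- Adaptive strategies with at most b plays, as decision trees.
-- A configuration gives the current state of each arm: 'just t' means the
-- arm is in the state whose subtree is t; 'nothing' means the arm was played
-- in a leaf state and cannot be played any more.

Config : ℕ → Set
Config n = Fin n → Maybe Tree

setArm : ∀ {n} → Config n → Fin n → Maybe Tree → Config n
setArm c i x = updateAt c i (λ _ → x)

data Strat {n : ℕ} : Config n → ℕ → Set where
  stop     : ∀ {c b} → Strat c b
  playNode : ∀ {c b r k p cs} (i : Fin n) → c i ≡ just (node r (suc k) p cs) →
             ((j : Fin (suc k)) → Strat (setArm c i (just (cs j))) b) →
             Strat c (suc b)
  playLeaf : ∀ {c b r p cs} (i : Fin n) → c i ≡ just (node r zero p cs) →
             Strat (setArm c i nothing) b → Strat c (suc b)

value : ∀ {n} {c : Config n} {b} → Strat c b → ℚ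
value stop = 0ℚ
value (playNode {r = r} {k = k} {p = p} i _ next) =
  r + sumFin (suc k) (λ j → p j * value (next j))
value (playLeaf {r = r} i _ s) = r + value s

initConfig : ∀ {n} → (Fin n → Tree) → Config n
initConfig T i = just (T i)

-- The linear program LP_mab.  Variables z, w : (u ∈ S) → time → ℚ;
-- only times t ∈ [1,B] are relevant.

Vars : ∀ {n} → (Fin n → Tree) → Set
Vars {n} T = (i : Fin n) → Pos (T i) → ℕ → ℚ

record LPFeasible {n : ℕ} (T : Fin n → Tree) (B : ℕ) (z w : Vars T) : Set where
  field
    z-range : ∀ i (u : Pos (T i)) t → 1 Data.Nat.≤ t → t Data.Nat.≤ B →
              (0ℚ ≤ z i u t) × (z i u t ≤ 1ℚ)
    w-range : ∀ i (u : Pos (T i)) t → 1 Data.Nat.≤ t → t Data.Nat.≤ B →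
              (0ℚ ≤ w i u t) × (w i u t ≤ 1ℚ)
    -- (1) w_{u,t} = z_{parent(u),t-1} p_{parent(u),u}, for non-root u = child j of v
    c1 : ∀ i (v : Pos (T i)) (j : Fin (children# (sub v))) t →
         2 Data.Nat.≤ t → t Data.Nat.≤ B →
         w i (extend v j) t ≡ z i v (t ∸ 1) * prob v j
    c2 : ∀ i (u : Pos (T i)) t → 1 Data.Nat.≤ t → t Data.Nat.≤ B →
         sumTo t (z i u) ≤ sumTo t (w i u)
    c3 : ∀ t → 1 Data.Nat.≤ t → t Data.Nat.≤ B →
         sumStates T (λ i u → z i u t) ≤ 1ℚ
    c4 : ∀ i → w i here 1 ≡ 1ℚ

objective : ∀ {n} (T : Fin n → Tree) (B : ℕ) → Vars T → ℚ
objective T B z = sumStates T (λ i u → sumTo B (λ t → rew u * z i u t))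

module Submission where

-- LPOpt ≥ Opt: every adaptive strategy σ induces a feasible point of LP_mab whose
-- objective value is the expected reward of σ.
--
-- The point is the occupation measure of σ: occ σ i π t is the probability that
-- the t-th play of σ is on arm i while arm i is in the state with address π
-- (child indices relative to the arm's current state).  With z_{u,t} := occ:
--   * each state is played at most once along a run, so its cumulative
--     occupation is at most 1; in particular every z_{u,t} lies in [0,1];
--   * the h-weighted total occupation 'load h σ t' obeys a one-step recursion
--     obtained by decomposing the first play of σ; with h = 1 it gives
--     constraint (3) (one play per step), with h = reward it gives
--     value σ = Σ_{u,t} r_u z_{u,t}.  Constraint (1) does not constrain time 1, so we
-- take w_{u,1} = 1; constraint (4) is then immediate and constraint (2) follows
-- from the cumulative bound on z.

open import Defs
open import Algebra.Bundles using (CommutativeRing; CommutativeMonoid)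
open import Data.Nat as ℕ using (ℕ; zero; suc; _∸_; s≤s)
open import Data.Fin using (Fin; zero; suc; toℕ; _≟_)
open import Data.Fin.Properties using (suc-injective)
open import Data.List using (List; []; _∷_; map; concatMap; allFin; _++_; tabulate)
open import Data.Maybe using (Maybe; just; nothing)
open import Data.Maybe.Properties using (just-injective)
open import Data.Product using (Σ; _×_; _,_; proj₁; proj₂)
open import Data.Sum using (_⊎_; inj₁; inj₂)
open import Data.Empty using (⊥-elim)
open import Data.Rational using (ℚ; 0ℚ; 1ℚ; _+_; _*_; _≤_; nonNegative)
import Data.Rational.Properties as Q
open import Data.Vec.Functional.Properties using (updateAt-updates; updateAt-minimal)
open import Function using (id; _∘_)
open import Relation.Binary.PropositionalEquality
open import Relation.Nullary using (Dec; yes; no)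

open import Algebra.Properties.Semiring.Sum (CommutativeRing.semiring Q.+-*-commutativeRing)
  using (sum; sum-cong-≗; sum-replicate-zero; ∑-distrib-+; ∑-comm; *-distribˡ-sum)
open import Algebra.Properties.CommutativeSemigroup
  (CommutativeMonoid.commutativeSemigroup Q.+-0-commutativeMonoid)
  using () renaming (interchange to +-interchange)
open import Algebra.Properties.CommutativeSemigroup
  (CommutativeMonoid.commutativeSemigroup Q.*-1-commutativeMonoid)
  using () renaming (x∙yz≈y∙xz to *-exchange)

open Q.≤-Reasoning hiding (stop)

0≤1 : 0ℚ ≤ 1ℚ
0≤1 = Q.nonNegative⁻¹ 1ℚ

InUnit : ℚ → Set
InUnit q = (0ℚ ≤ q) × (q ≤ 1ℚ)

+-nonneg : ∀ {a b} → 0ℚ ≤ a → 0ℚ ≤ b → 0ℚ ≤ a + b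
+-nonneg {a} {b} a≥0 b≥0 =
  Q.nonNegative⁻¹ (a + b) {{Q.nonNeg+nonNeg⇒nonNeg a {{nonNegative a≥0}} b {{nonNegative b≥0}}}}

*-nonneg : ∀ {a b} → 0ℚ ≤ a → 0ℚ ≤ b → 0ℚ ≤ a * b
*-nonneg {a} {b} a≥0 b≥0 =
  Q.nonNegative⁻¹ (a * b) {{Q.nonNeg*nonNeg⇒nonNeg a {{nonNegative a≥0}} b {{nonNegative b≥0}}}}

*-monoʳ-≤ : ∀ {a x y} → 0ℚ ≤ a → x ≤ y → a * x ≤ a * y
*-monoʳ-≤ {a} a≥0 = Q.*-monoˡ-≤-nonNeg a {{nonNegative a≥0}}

*-≤-left : ∀ {a x} → 0ℚ ≤ a → x ≤ 1ℚ → a * x ≤ a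
*-≤-left {a} a≥0 x≤1 = Q.≤-trans (*-monoʳ-≤ a≥0 x≤1) (Q.≤-reflexive (Q.*-identityʳ a))

InUnit-* : ∀ {a b} → InUnit a → InUnit b → InUnit (a * b)
InUnit-* (a≥0 , a≤1) (b≥0 , b≤1) = *-nonneg a≥0 b≥0 , Q.≤-trans (*-≤-left a≥0 b≤1) a≤1

sumFin≡sum : ∀ k (f : Fin k → ℚ) → sumFin k f ≡ sum f
sumFin≡sum zero    f = refl
sumFin≡sum (suc k) f = cong (f zero +_) (sumFin≡sum k (f ∘ suc))

sumFin-cong : ∀ k {f g : Fin k → ℚ} → (∀ j → f j ≡ g j) → sumFin k f ≡ sumFin k g
sumFin-cong k {f} {g} f≗g =
  trans (sumFin≡sum k f) (trans (sum-cong-≗ f≗g) (sym (sumFin≡sum k g)))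

sumFin-zero : ∀ k {f : Fin k → ℚ} → (∀ j → f j ≡ 0ℚ) → sumFin k f ≡ 0ℚ
sumFin-zero k f≗0 =
  trans (sumFin-cong k f≗0) (trans (sumFin≡sum k _) (sum-replicate-zero k))

sumFin-+ : ∀ k (f g : Fin k → ℚ) → sumFin k (λ j → f j + g j) ≡ sumFin k f + sumFin k g
sumFin-+ k f g = trans (sumFin≡sum k _)
  (trans (∑-distrib-+ f g) (sym (cong₂ _+_ (sumFin≡sum k f) (sumFin≡sum k g))))

sumFin-* : ∀ k a (f : Fin k → ℚ) → sumFin k (λ j → a * f j) ≡ a * sumFin k f
sumFin-* k a f = trans (sumFin≡sum k _)
  (trans (sym (*-distribˡ-sum a f)) (cong (a *_) (sym (sumFin≡sum k f))))

sumFin-comm : ∀ m k (f : Fin m → Fin k → ℚ) →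
  sumFin m (λ i → sumFin k (f i)) ≡ sumFin k (λ j → sumFin m (λ i → f i j))
sumFin-comm m k f = trans (asSum m k f) (trans (∑-comm f) (sym (asSum k m (λ j i → f i j))))
  where
  asSum : ∀ m k (f : Fin m → Fin k → ℚ) → sumFin m (λ i → sumFin k (f i)) ≡ sum (λ i → sum (f i))
  asSum m k f = trans (sumFin-cong m (λ i → sumFin≡sum k (f i))) (sumFin≡sum m _)

sumFin-mono : ∀ k {f g : Fin k → ℚ} → (∀ j → f j ≤ g j) → sumFin k f ≤ sumFin k g
sumFin-mono zero    f≤g = Q.≤-refl
sumFin-mono (suc k) f≤g = Q.+-mono-≤ (f≤g zero) (sumFin-mono k (f≤g ∘ suc))

sumFin-nonneg : ∀ k {f : Fin k → ℚ} → (∀ j → 0ℚ ≤ f j) → 0ℚ ≤ sumFin k f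
sumFin-nonneg k f≥0 =
  Q.≤-trans (Q.≤-reflexive (sym (sumFin-zero k {λ _ → 0ℚ} (λ _ → refl)))) (sumFin-mono k f≥0)

sumFin-term : ∀ k {f : Fin k → ℚ} → (∀ j → 0ℚ ≤ f j) → ∀ j → f j ≤ sumFin k f
sumFin-term (suc k) {f} f≥0 zero = begin
  f zero                               ≡⟨ Q.+-identityʳ (f zero) ⟨
  f zero + 0ℚ                          ≤⟨ Q.+-monoʳ-≤ (f zero) (sumFin-nonneg k (f≥0 ∘ suc)) ⟩
  f zero + sumFin k (f ∘ suc)          ∎
sumFin-term (suc k) {f} f≥0 (suc j) = begin
  f (suc j)                            ≡⟨ Q.+-identityˡ (f (suc j)) ⟨
  0ℚ + f (suc j)                       ≤⟨ Q.+-mono-≤ (f≥0 zero) (sumFin-term k (f≥0 ∘ suc) j) ⟩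
  f zero + sumFin k (f ∘ suc)          ∎

sumFin-single : ∀ k {f : Fin k → ℚ} (i : Fin k) → (∀ j → j ≢ i → f j ≡ 0ℚ) → sumFin k f ≡ f i
sumFin-single (suc k) {f} zero f≗0 =
  trans (cong (f zero +_) (sumFin-zero k (λ j → f≗0 (suc j) λ ())) ) (Q.+-identityʳ (f zero))
sumFin-single (suc k) {f} (suc i) f≗0 =
  trans (cong₂ _+_ (f≗0 zero λ ()) (sumFin-single k i (λ j j≢i → f≗0 (suc j) (j≢i ∘ suc-injective))))
        (Q.+-identityˡ (f (suc i)))

when : ∀ {A : Set} → Dec A → ℚ → ℚ
when (yes _) a = a
when (no _)  a = 0ℚ

sumFin-when : ∀ n (i₀ : Fin n) a → sumFin n (λ i → when (i ≟ i₀) a) ≡ a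
sumFin-when n i₀ a = trans (sumFin-single n i₀ (λ i i≢i₀ → off (i ≟ i₀) i≢i₀)) (on (i₀ ≟ i₀))
  where
  off : ∀ {i} (d : Dec (i ≡ i₀)) → i ≢ i₀ → when d a ≡ 0ℚ
  off (yes i≡i₀) i≢i₀ = ⊥-elim (i≢i₀ i≡i₀)
  off (no _)     _    = refl
  on : (d : Dec (i₀ ≡ i₀)) → when d a ≡ a
  on (yes _)    = refl
  on (no i₀≢i₀) = ⊥-elim (i₀≢i₀ refl)

-- Sums over time: sumTo t f = Σ_{s=1}^{t} f s only reads f at positive times.

sumTo-cong : ∀ t {f g : ℕ → ℚ} → (∀ s → f (suc s) ≡ g (suc s)) → sumTo t f ≡ sumTo t g
sumTo-cong zero    f≗g = refl
sumTo-cong (suc t) f≗g = cong₂ _+_ (sumTo-cong t f≗g) (f≗g t)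

sumTo-zero : ∀ t {f : ℕ → ℚ} → (∀ s → f (suc s) ≡ 0ℚ) → sumTo t f ≡ 0ℚ
sumTo-zero zero    f≗0 = refl
sumTo-zero (suc t) f≗0 = trans (cong₂ _+_ (sumTo-zero t f≗0) (f≗0 t)) (Q.+-identityʳ 0ℚ)

sumTo-+ : ∀ t (f g : ℕ → ℚ) → sumTo t (λ s → f s + g s) ≡ sumTo t f + sumTo t g
sumTo-+ zero    f g = sym (Q.+-identityʳ 0ℚ)
sumTo-+ (suc t) f g = trans (cong (_+ (f (suc t) + g (suc t))) (sumTo-+ t f g))
  (+-interchange (sumTo t f) (sumTo t g) (f (suc t)) (g (suc t)))

sumTo-* : ∀ t a (f : ℕ → ℚ) → sumTo t (λ s → a * f s) ≡ a * sumTo t f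
sumTo-* zero    a f = sym (Q.*-zeroʳ a)
sumTo-* (suc t) a f =
  trans (cong (_+ (a * f (suc t))) (sumTo-* t a f)) (sym (Q.*-distribˡ-+ a _ _))

sumTo-sumFin : ∀ t k (f : ℕ → Fin k → ℚ) →
  sumTo t (λ s → sumFin k (f s)) ≡ sumFin k (λ j → sumTo t (λ s → f s j))
sumTo-sumFin zero    k f = sym (sumFin-zero k (λ _ → refl))
sumTo-sumFin (suc t) k f =
  trans (cong (_+ sumFin k (f (suc t))) (sumTo-sumFin t k f)) (sym (sumFin-+ k _ (f (suc t))))

sumTo-mix : ∀ t k (p : Fin k → ℚ) (f : Fin k → ℕ → ℚ) →
  sumTo t (λ s → sumFin k (λ j → p j * f j s)) ≡ sumFin k (λ j → p j * sumTo t (f j))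
sumTo-mix t k p f =
  trans (sumTo-sumFin t k (λ s j → p j * f j s)) (sumFin-cong k (λ j → sumTo-* t (p j) (f j)))

sumTo-shift : ∀ t (f : ℕ → ℚ) → sumTo (suc t) f ≡ f 1 + sumTo t (f ∘ suc)
sumTo-shift zero    f = trans (Q.+-identityˡ (f 1)) (sym (Q.+-identityʳ (f 1)))
sumTo-shift (suc t) f =
  trans (cong (_+ f (suc (suc t))) (sumTo-shift t f)) (Q.+-assoc (f 1) _ (f (suc (suc t))))

sumTo-nonneg : ∀ t {f : ℕ → ℚ} → (∀ s → 0ℚ ≤ f (suc s)) → 0ℚ ≤ sumTo t f
sumTo-nonneg zero    f≥0 = Q.≤-refl
sumTo-nonneg (suc t) f≥0 = +-nonneg (sumTo-nonneg t f≥0) (f≥0 t)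

sumTo-first : ∀ t {f : ℕ → ℚ} → (∀ s → 0ℚ ≤ f (suc (suc s))) → f 1 ≤ sumTo (suc t) f
sumTo-first t {f} f≥0 = begin
  f 1                      ≡⟨ Q.+-identityʳ (f 1) ⟨
  f 1 + 0ℚ                 ≤⟨ Q.+-monoʳ-≤ (f 1) (sumTo-nonneg t f≥0) ⟩
  f 1 + sumTo t (f ∘ suc)  ≡⟨ sumTo-shift t f ⟨
  sumTo (suc t) f          ∎

sumTo-last : ∀ t {f : ℕ → ℚ} → (∀ s → 0ℚ ≤ f (suc s)) → f (suc t) ≤ sumTo (suc t) f
sumTo-last t {f} f≥0 = begin
  f (suc t)                ≡⟨ Q.+-identityˡ (f (suc t)) ⟨
  0ℚ + f (suc t)           ≤⟨ Q.+-monoˡ-≤ (f (suc t)) (sumTo-nonneg t f≥0) ⟩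
  sumTo t f + f (suc t)    ∎

sumL : ∀ {A : Set} → List A → (A → ℚ) → ℚ
sumL xs f = sumList (map f xs)

sumL-cong : ∀ {A : Set} (xs : List A) {f g : A → ℚ} → (∀ x → f x ≡ g x) → sumL xs f ≡ sumL xs g
sumL-cong []       f≗g = refl
sumL-cong (x ∷ xs) f≗g = cong₂ _+_ (f≗g x) (sumL-cong xs f≗g)

sumL-zero : ∀ {A : Set} (xs : List A) {f : A → ℚ} → (∀ x → f x ≡ 0ℚ) → sumL xs f ≡ 0ℚ
sumL-zero []       f≗0 = refl
sumL-zero (x ∷ xs) f≗0 = trans (cong₂ _+_ (f≗0 x) (sumL-zero xs f≗0)) (Q.+-identityʳ 0ℚ)

sumL-* : ∀ {A : Set} (xs : List A) a (f : A → ℚ) → sumL xs (λ x → a * f x) ≡ a * sumL xs f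
sumL-* []       a f = sym (Q.*-zeroʳ a)
sumL-* (x ∷ xs) a f = trans (cong (a * f x +_) (sumL-* xs a f)) (sym (Q.*-distribˡ-+ a _ _))

sumL-sumFin : ∀ {A : Set} (xs : List A) k (f : A → Fin k → ℚ) →
  sumL xs (λ x → sumFin k (f x)) ≡ sumFin k (λ j → sumL xs (λ x → f x j))
sumL-sumFin []       k f = sym (sumFin-zero k (λ _ → refl))
sumL-sumFin (x ∷ xs) k f =
  trans (cong (sumFin k (f x) +_) (sumL-sumFin xs k f)) (sym (sumFin-+ k (f x) _))

sumL-sumTo : ∀ {A : Set} (xs : List A) t (f : A → ℕ → ℚ) →
  sumL xs (λ x → sumTo t (f x)) ≡ sumTo t (λ s → sumL xs (λ x → f x s))
sumL-sumTo []       t f = sym (sumTo-zero t (λ _ → refl))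
sumL-sumTo (x ∷ xs) t f =
  trans (cong (sumTo t (f x) +_) (sumL-sumTo xs t f)) (sym (sumTo-+ t (f x) _))

sumL-++ : ∀ {A : Set} (xs ys : List A) f → sumL (xs ++ ys) f ≡ sumL xs f + sumL ys f
sumL-++ []       ys f = sym (Q.+-identityˡ _)
sumL-++ (x ∷ xs) ys f =
  trans (cong (f x +_) (sumL-++ xs ys f)) (sym (Q.+-assoc (f x) (sumL xs f) (sumL ys f)))

sumL-map : ∀ {A B : Set} (xs : List A) (g : A → B) f → sumL (map g xs) f ≡ sumL xs (f ∘ g)
sumL-map []       g f = refl
sumL-map (x ∷ xs) g f = cong (f (g x) +_) (sumL-map xs g f)

sumL-concatMap : ∀ {A B : Set} (xs : List A) (h : A → List B) f →
  sumL (concatMap h xs) f ≡ sumL xs (λ x → sumL (h x) f)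
sumL-concatMap []       h f = refl
sumL-concatMap (x ∷ xs) h f =
  trans (sumL-++ (h x) (concatMap h xs) f) (cong (sumL (h x) f +_) (sumL-concatMap xs h f))

sumL-tabulate : ∀ k {B : Set} (g : Fin k → B) f → sumL (tabulate g) f ≡ sumFin k (f ∘ g)
sumL-tabulate zero    g f = refl
sumL-tabulate (suc k) g f = cong (f (g zero) +_) (sumL-tabulate k (g ∘ suc) f)

-- Sums over the states of an arm.  A state is described by its subtree and
-- its address; an arm that was played in a leaf ('nothing') has no states.

address : ∀ {tr} → Pos tr → List ℕ
address here       = []
address (into j u) = toℕ j ∷ address u

states : Maybe Tree → List (Tree × List ℕ)
states nothing   = []
states (just tr) = map (λ u → sub u , address u) (allPos tr)

armSum : Maybe Tree → (Tree → List ℕ → ℚ) → ℚ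
armSum x g = sumL (states x) (λ (sb , π) → g sb π)

armSum-just : ∀ tr (g : Tree → List ℕ → ℚ) →
  armSum (just tr) g ≡ sumList (map (λ u → g (sub u) (address u)) (allPos tr))
armSum-just tr g = sumL-map (allPos tr) (λ u → sub u , address u) (λ (sb , π) → g sb π)

armSum-node : ∀ r k p cs (g : Tree → List ℕ → ℚ) →
  armSum (just (node r k p cs)) g ≡
  g (node r k p cs) [] + sumFin k (λ j → armSum (just (cs j)) (λ sb π → g sb (toℕ j ∷ π)))
armSum-node r k p cs g = cong (g (node r k p cs) [] +_) (begin-equality
  sumL (map ρ (concatMap children (allFin k))) f
    ≡⟨ sumL-map (concatMap children (allFin k)) ρ f ⟩
  sumL (concatMap children (allFin k)) (f ∘ ρ)
    ≡⟨ sumL-concatMap (allFin k) children (f ∘ ρ) ⟩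
  sumL (allFin k) (λ j → sumL (children j) (f ∘ ρ))
    ≡⟨ sumL-tabulate k id (λ j → sumL (children j) (f ∘ ρ)) ⟩
  sumFin k (λ j → sumL (children j) (f ∘ ρ))
    ≡⟨ sumFin-cong k (λ j → trans (sumL-map (allPos (cs j)) (into j) (f ∘ ρ))
                                  (sym (armSum-just (cs j) (λ sb π → g sb (toℕ j ∷ π))))) ⟩
  sumFin k (λ j → armSum (just (cs j)) (λ sb π → g sb (toℕ j ∷ π))) ∎)
  where
  ρ : Pos (node r k p cs) → Tree × List ℕ
  ρ u = sub u , address u
  f : Tree × List ℕ → ℚ
  f (sb , π) = g sb π
  children : Fin k → List (Pos (node r k p cs))
  children j = map (into j) (allPos (cs j))

IsDist : (k : ℕ) → (Fin k → ℚ) → Set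
IsDist k p = ((j : Fin k) → 0ℚ ≤ p j) × (sumFin k p ≡ 1ℚ)

node-dist : ∀ {r k p cs} → WF (node r (suc k) p cs) → IsDist (suc k) p
node-dist (p>0 , Σp≡1 , _) = (λ j → Q.<⇒≤ (p>0 j)) , Σp≡1

dist-InUnit : ∀ {k p} → IsDist k p → ∀ j → InUnit (p j)
dist-InUnit {k} (p≥0 , Σp≡1) j = p≥0 j , Q.≤-trans (sumFin-term k p≥0 j) (Q.≤-reflexive Σp≡1)

dist-average-≤1 : ∀ {k p} {x : Fin k → ℚ} → IsDist k p → (∀ j → x j ≤ 1ℚ) →
  sumFin k (λ j → p j * x j) ≤ 1ℚ
dist-average-≤1 {k} {p} {x} (p≥0 , Σp≡1) x≤1 = begin
  sumFin k (λ j → p j * x j) ≤⟨ sumFin-mono k (λ j → *-≤-left (p≥0 j) (x≤1 j)) ⟩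
  sumFin k p                 ≡⟨ Σp≡1 ⟩
  1ℚ                         ∎

WFConfig : ∀ {n} → Config n → Set
WFConfig {n} c = ∀ (i : Fin n) tr → c i ≡ just tr → WF tr

played-dist : ∀ {n} {c : Config n} {i₀ r k p cs} → WFConfig c →
  c i₀ ≡ just (node r (suc k) p cs) → IsDist (suc k) p
played-dist {i₀ = i₀} {r} {k} {p} {cs} wfc eq = node-dist {r} {k} {p} {cs} (wfc i₀ _ eq)

WFConfig-node : ∀ {n} {c : Config n} {i₀ r k p cs} → WFConfig c →
  c i₀ ≡ just (node r (suc k) p cs) → ∀ j → WFConfig (setArm c i₀ (just (cs j)))
WFConfig-node {c = c} {i₀} wfc eq j i tr e with i ≟ i₀
... | yes refl = subst WF (just-injective (trans (sym (updateAt-updates i c)) e))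
                   (proj₂ (proj₂ (wfc i _ eq)) j)
... | no i≢i₀  = wfc i tr (trans (sym (updateAt-minimal i i₀ c i≢i₀)) e)

WFConfig-leaf : ∀ {n} {c : Config n} {i₀} → WFConfig c → WFConfig (setArm c i₀ nothing)
WFConfig-leaf {c = c} {i₀} wfc i tr e with i ≟ i₀
... | yes refl with () ← trans (sym (updateAt-updates i c)) e
... | no i≢i₀  = wfc i tr (trans (sym (updateAt-minimal i i₀ c i≢i₀)) e)

-- time profile of "played right now"
now : ℕ → ℚ
now zero    = 1ℚ
now (suc _) = 0ℚ

entry : (k : ℕ) → ℕ → (Fin k → ℚ) → ℚ
entry zero    m       g = 0ℚ
entry (suc k) zero    g = g zero
entry (suc k) (suc m) g = entry k m (g ∘ suc)

entry-toℕ : ∀ k (j : Fin k) g → entry k (toℕ j) g ≡ g j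
entry-toℕ (suc k) zero    g = refl
entry-toℕ (suc k) (suc j) g = entry-toℕ k j (g ∘ suc)

entry-view : ∀ k m → (Σ (Fin k) λ j → ∀ g → entry k m g ≡ g j) ⊎ (∀ g → entry k m g ≡ 0ℚ)
entry-view zero    m = inj₂ (λ g → refl)
entry-view (suc k) zero = inj₁ (zero , λ g → refl)
entry-view (suc k) (suc m) with entry-view k m
... | inj₁ (j , e) = inj₁ (suc j , λ g → e (g ∘ suc))
... | inj₂ e       = inj₂ (λ g → e (g ∘ suc))

-- Occupation t steps after playing a node with child probabilities p, of the
-- state at address π of some arm; O j is the occupation after moving to child j,
-- d decides whether the arm is the played one (whose addresses then move down).
afterNode : ∀ {A : Set} → Dec A → (k : ℕ) → (Fin k → ℚ) → (Fin k → List ℕ → ℕ → ℚ) →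
  List ℕ → ℕ → ℚ
afterNode (yes _) k p O []      t = now t
afterNode (yes _) k p O (m ∷ π) t = entry k m (λ j → p j * O j π t)
afterNode (no _)  k p O π       t = sumFin k (λ j → p j * O j π t)

afterLeaf : ∀ {A : Set} → Dec A → (List ℕ → ℕ → ℚ) → List ℕ → ℕ → ℚ
afterLeaf (yes _) O []      t = now t
afterLeaf (yes _) O (_ ∷ _) t = 0ℚ
afterLeaf (no _)  O π       t = O π t

-- occ σ i π t: probability that the t-th play of σ is arm i in the state at address π
occ : ∀ {n} {c : Config n} {b} → Strat c b → Fin n → List ℕ → ℕ → ℚ
occ stop                i π t       = 0ℚ
occ (playNode _ _ _)    i π zero    = 0ℚ
occ (playNode {k = k} {p = p} i₀ _ next) i π (suc t) =
  afterNode (i ≟ i₀) (suc k) p (λ j → occ (next j) i) π t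
occ (playLeaf _ _ _)    i π zero    = 0ℚ
occ (playLeaf i₀ _ s)   i π (suc t) = afterLeaf (i ≟ i₀) (occ s i) π t

occ-at-0 : ∀ {n} {c : Config n} {b} (σ : Strat c b) i π → occ σ i π 0 ≡ 0ℚ
occ-at-0 stop             i π = refl
occ-at-0 (playNode _ _ _) i π = refl
occ-at-0 (playLeaf _ _ _) i π = refl

now-nonneg : ∀ t → 0ℚ ≤ now t
now-nonneg zero    = 0≤1
now-nonneg (suc t) = Q.≤-refl

afterNode-nonneg : ∀ {A : Set} (d : Dec A) k {p O} → (∀ j → 0ℚ ≤ p j) →
  (∀ j π t → 0ℚ ≤ O j π t) → ∀ π t → 0ℚ ≤ afterNode d k p O π t
afterNode-nonneg (yes _) k p≥0 O≥0 []      t = now-nonneg t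
afterNode-nonneg (yes _) k p≥0 O≥0 (m ∷ π) t with entry-view k m
... | inj₁ (j , e) = Q.≤-trans (*-nonneg (p≥0 j) (O≥0 j π t)) (Q.≤-reflexive (sym (e _)))
... | inj₂ e       = Q.≤-reflexive (sym (e _))
afterNode-nonneg (no _)  k p≥0 O≥0 π       t = sumFin-nonneg k (λ j → *-nonneg (p≥0 j) (O≥0 j π t))

afterLeaf-nonneg : ∀ {A : Set} (d : Dec A) {O} → (∀ π t → 0ℚ ≤ O π t) →
  ∀ π t → 0ℚ ≤ afterLeaf d O π t
afterLeaf-nonneg (yes _) O≥0 []      t = now-nonneg t
afterLeaf-nonneg (yes _) O≥0 (_ ∷ _) t = Q.≤-refl
afterLeaf-nonneg (no _)  O≥0 π       t = O≥0 π t

occ-nonneg : ∀ {n} {c : Config n} {b} (σ : Strat c b) → WFConfig c → ∀ i π t → 0ℚ ≤ occ σ i π t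
occ-nonneg stop wfc i π t = Q.≤-refl
occ-nonneg (playNode _ _ _) wfc i π zero = Q.≤-refl
occ-nonneg (playNode {k = k} i₀ eq next) wfc i π (suc t) =
  afterNode-nonneg (i ≟ i₀) (suc k) (proj₁ (played-dist wfc eq))
    (λ j → occ-nonneg (next j) (WFConfig-node wfc eq j) i) π t
occ-nonneg (playLeaf _ _ _) wfc i π zero = Q.≤-refl
occ-nonneg (playLeaf i₀ eq s) wfc i π (suc t) =
  afterLeaf-nonneg (i ≟ i₀) (occ-nonneg s (WFConfig-leaf wfc) i) π t

now-total : ∀ t → now 0 + sumTo t now ≤ 1ℚ
now-total t = Q.≤-reflexive (trans (cong (1ℚ +_) (sumTo-zero t (λ _ → refl))) (Q.+-identityʳ 1ℚ))

afterNode-cumulative : ∀ {A : Set} (d : Dec A) k {p O} → IsDist k p →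
  (∀ j π → O j π 0 ≡ 0ℚ) → (∀ j π t → sumTo t (O j π) ≤ 1ℚ) →
  ∀ π t → afterNode d k p O π 0 + sumTo t (afterNode d k p O π) ≤ 1ℚ
afterNode-cumulative (yes _) k dist O0 O≤1 [] t = now-total t
afterNode-cumulative (yes _) k {p} {O} dist O0 O≤1 (m ∷ π) t with entry-view k m
... | inj₁ (j , e) = begin
  entry k m (λ j' → p j' * O j' π 0) + sumTo t (λ s → entry k m (λ j' → p j' * O j' π s))
    ≡⟨ cong₂ _+_ (trans (e _) (trans (cong (p j *_) (O0 j π)) (Q.*-zeroʳ (p j))))
                 (trans (sumTo-cong t (λ s → e _)) (sumTo-* t (p j) (O j π))) ⟩
  0ℚ + p j * sumTo t (O j π)
    ≤⟨ Q.≤-trans (Q.≤-reflexive (Q.+-identityˡ _)) (*-≤-left (proj₁ dist j) (O≤1 j π t)) ⟩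
  p j
    ≤⟨ proj₂ (dist-InUnit dist j) ⟩
  1ℚ ∎
... | inj₂ e = Q.≤-trans
  (Q.≤-reflexive (trans (cong₂ _+_ (e _) (sumTo-zero t (λ s → e _))) (Q.+-identityʳ 0ℚ))) 0≤1
afterNode-cumulative (no _) k {p} {O} dist O0 O≤1 π t = begin
  sumFin k (λ j → p j * O j π 0) + sumTo t (λ s → sumFin k (λ j → p j * O j π s))
    ≡⟨ cong₂ _+_ (sumFin-zero k (λ j → trans (cong (p j *_) (O0 j π)) (Q.*-zeroʳ (p j))))
                 (sumTo-mix t k p (λ j → O j π)) ⟩
  0ℚ + sumFin k (λ j → p j * sumTo t (O j π))
    ≡⟨ Q.+-identityˡ _ ⟩
  sumFin k (λ j → p j * sumTo t (O j π))
    ≤⟨ dist-average-≤1 dist (λ j → O≤1 j π t) ⟩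
  1ℚ ∎

afterLeaf-cumulative : ∀ {A : Set} (d : Dec A) {O} → (∀ π → O π 0 ≡ 0ℚ) →
  (∀ π t → sumTo t (O π) ≤ 1ℚ) → ∀ π t → afterLeaf d O π 0 + sumTo t (afterLeaf d O π) ≤ 1ℚ
afterLeaf-cumulative (yes _) O0 O≤1 []      t = now-total t
afterLeaf-cumulative (yes _) O0 O≤1 (_ ∷ _) t = Q.≤-trans
  (Q.≤-reflexive (trans (cong (0ℚ +_) (sumTo-zero t (λ _ → refl))) (Q.+-identityʳ 0ℚ))) 0≤1
afterLeaf-cumulative (no _) {O} O0 O≤1 π t =
  Q.≤-trans (Q.≤-reflexive (trans (cong (_+ sumTo t (O π)) (O0 π)) (Q.+-identityˡ _))) (O≤1 π t)

-- Each state is played at most once along a run: its cumulative occupation is ≤ 1.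
occ-cumulative-≤1 : ∀ {n} {c : Config n} {b} (σ : Strat c b) → WFConfig c →
  ∀ i π t → sumTo t (occ σ i π) ≤ 1ℚ
occ-cumulative-≤1 σ wfc i π zero = 0≤1
occ-cumulative-≤1 stop wfc i π (suc t) =
  Q.≤-trans (Q.≤-reflexive (sumTo-zero (suc t) (λ _ → refl))) 0≤1
occ-cumulative-≤1 σ@(playNode {k = k} i₀ eq next) wfc i π (suc t) =
  Q.≤-trans (Q.≤-reflexive (sumTo-shift t (occ σ i π)))
    (afterNode-cumulative (i ≟ i₀) (suc k) (played-dist wfc eq)
      (λ j → occ-at-0 (next j) i) (λ j → occ-cumulative-≤1 (next j) (WFConfig-node wfc eq j) i) π t)
occ-cumulative-≤1 σ@(playLeaf i₀ eq s) wfc i π (suc t) =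
  Q.≤-trans (Q.≤-reflexive (sumTo-shift t (occ σ i π)))
    (afterLeaf-cumulative (i ≟ i₀) (occ-at-0 s i) (occ-cumulative-≤1 s (WFConfig-leaf wfc) i) π t)

occ-InUnit : ∀ {n} {c : Config n} {b} (σ : Strat c b) → WFConfig c → ∀ i π t → InUnit (occ σ i π t)
occ-InUnit σ wfc i π t = occ-nonneg σ wfc i π t , occ-≤1 t
  where
  occ-≤1 : ∀ t → occ σ i π t ≤ 1ℚ
  occ-≤1 zero    = Q.≤-trans (Q.≤-reflexive (occ-at-0 σ i π)) 0≤1
  occ-≤1 (suc t) = Q.≤-trans (sumTo-last t (λ s → occ-nonneg σ wfc i π (suc s)))
                             (occ-cumulative-≤1 σ wfc i π (suc t))

load : ∀ {n} {c : Config n} {b} → (Tree → ℚ) → Strat c b → ℕ → ℚ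
load {n} {c} h σ t = sumFin n (λ i → armSum (c i) (λ sb π → h sb * occ σ i π t))

load-null : ∀ {n} {c : Config n} {b} h (σ : Strat c b) t → (∀ i π → occ σ i π t ≡ 0ℚ) →
  load h σ t ≡ 0ℚ
load-null {n} {c} h σ t occ≡0 = sumFin-zero n (λ i → sumL-zero (states (c i))
  (λ (sb , π) → trans (cong (h sb *_) (occ≡0 i π)) (Q.*-zeroʳ (h sb))))

load-at-0 : ∀ {n} {c : Config n} {b} h (σ : Strat c b) → load h σ 0 ≡ 0ℚ
load-at-0 h σ = load-null h σ 0 (occ-at-0 σ)

load-arm-node : ∀ {n} {c : Config n} {b r k p cs} (h : Tree → ℚ) (i₀ : Fin n) →
  c i₀ ≡ just (node r (suc k) p cs) → (next : ∀ j → Strat (setArm c i₀ (just (cs j))) b) →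
  ∀ i (d : Dec (i ≡ i₀)) t →
  armSum (c i) (λ sb π → h sb * afterNode d (suc k) p (λ j → occ (next j) i) π t) ≡
  when d (h (node r (suc k) p cs) * now t) +
  sumFin (suc k) (λ j → p j * armSum (setArm c i₀ (just (cs j)) i) (λ sb π → h sb * occ (next j) i π t))
load-arm-node {c = c} {r = r} {k} {p} {cs} h i eq next i (yes refl) t = begin-equality
  armSum (c i) F
    ≡⟨ cong (λ x → armSum x F) eq ⟩
  armSum (just (node r (suc k) p cs)) F
    ≡⟨ armSum-node r (suc k) p cs F ⟩
  h (node r (suc k) p cs) * now t + sumFin (suc k) (λ j → armSum (just (cs j)) (λ sb π → F sb (toℕ j ∷ π)))
    ≡⟨ cong (h (node r (suc k) p cs) * now t +_) (sumFin-cong (suc k) child) ⟩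
  h (node r (suc k) p cs) * now t + sumFin (suc k) (λ j → p j * armSum (setArm c i (just (cs j)) i) (G j)) ∎
  where
  F : Tree → List ℕ → ℚ
  F sb π = h sb * afterNode (yes refl) (suc k) p (λ j → occ (next j) i) π t
  G : Fin (suc k) → Tree → List ℕ → ℚ
  G j sb π = h sb * occ (next j) i π t
  child : ∀ j → armSum (just (cs j)) (λ sb π → F sb (toℕ j ∷ π)) ≡ p j * armSum (setArm c i (just (cs j)) i) (G j)
  child j = begin-equality
    armSum (just (cs j)) (λ sb π → F sb (toℕ j ∷ π))
      ≡⟨ sumL-cong (states (just (cs j))) (λ (sb , π) →
           trans (cong (h sb *_) (entry-toℕ (suc k) j (λ j' → p j' * occ (next j') i π t)))
                 (*-exchange (h sb) (p j) _)) ⟩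
    armSum (just (cs j)) (λ sb π → p j * G j sb π)
      ≡⟨ sumL-* (states (just (cs j))) (p j) _ ⟩
    p j * armSum (just (cs j)) (G j)
      ≡⟨ cong (λ x → p j * armSum x (G j)) (updateAt-updates i {λ _ → just (cs j)} c) ⟨
    p j * armSum (setArm c i (just (cs j)) i) (G j) ∎
load-arm-node {c = c} {k = k} {p} {cs} h i₀ eq next i (no i≢i₀) t = begin-equality
  armSum (c i) (λ sb π → h sb * sumFin (suc k) (λ j → p j * G j π))
    ≡⟨ sumL-cong (states (c i)) (λ (sb , π) → trans (sym (sumFin-* (suc k) (h sb) (λ j → p j * G j π)))
         (sumFin-cong (suc k) (λ j → *-exchange (h sb) (p j) (G j π)))) ⟩
  armSum (c i) (λ sb π → sumFin (suc k) (λ j → p j * (h sb * G j π)))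
    ≡⟨ sumL-sumFin (states (c i)) (suc k) (λ (sb , π) j → p j * (h sb * G j π)) ⟩
  sumFin (suc k) (λ j → armSum (c i) (λ sb π → p j * (h sb * G j π)))
    ≡⟨ sumFin-cong (suc k) (λ j → trans (sumL-* (states (c i)) (p j) _)
         (cong (λ x → p j * armSum x (λ sb π → h sb * G j π)) (sym (updateAt-minimal i i₀ {λ _ → just (cs j)} c i≢i₀)))) ⟩
  sumFin (suc k) (λ j → p j * armSum (setArm c i₀ (just (cs j)) i) (λ sb π → h sb * G j π))
    ≡⟨ Q.+-identityˡ _ ⟨
  0ℚ + sumFin (suc k) (λ j → p j * armSum (setArm c i₀ (just (cs j)) i) (λ sb π → h sb * G j π)) ∎
  where
  G : Fin (suc k) → List ℕ → ℚ
  G j π = occ (next j) i π t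

load-arm-leaf : ∀ {n} {c : Config n} {b r p cs} (h : Tree → ℚ) (i₀ : Fin n) →
  c i₀ ≡ just (node r zero p cs) → (s : Strat (setArm c i₀ nothing) b) →
  ∀ i (d : Dec (i ≡ i₀)) t →
  armSum (c i) (λ sb π → h sb * afterLeaf d (occ s i) π t) ≡
  when d (h (node r zero p cs) * now t) + armSum (setArm c i₀ nothing i) (λ sb π → h sb * occ s i π t)
load-arm-leaf {c = c} {r = r} {p} {cs} h i eq s i (yes refl) t =
  trans (cong (λ x → armSum x (λ sb π → h sb * afterLeaf (yes refl) (occ s i) π t)) eq)
        (cong (λ x → h (node r zero p cs) * now t + armSum x (λ sb π → h sb * occ s i π t))
              (sym (updateAt-updates i {λ _ → nothing} c)))
load-arm-leaf {c = c} h i₀ eq s i (no i≢i₀) t = sym (trans (Q.+-identityˡ _)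
  (cong (λ x → armSum x (λ sb π → h sb * occ s i π t)) (updateAt-minimal i i₀ {λ _ → nothing} c i≢i₀)))

load-node : ∀ {n} {c : Config n} {b r k p cs} (h : Tree → ℚ) (i₀ : Fin n)
  (eq : c i₀ ≡ just (node r (suc k) p cs)) (next : ∀ j → Strat (setArm c i₀ (just (cs j))) b) t →
  load h (playNode i₀ eq next) (suc t) ≡
  h (node r (suc k) p cs) * now t + sumFin (suc k) (λ j → p j * load h (next j) t)
load-node {n} {c} {r = r} {k} {p} {cs} h i₀ eq next t = begin-equality
  load h (playNode i₀ eq next) (suc t)
    ≡⟨ sumFin-cong n (λ i → load-arm-node h i₀ eq next i (i ≟ i₀) t) ⟩
  sumFin n (λ i → when (i ≟ i₀) a + sumFin (suc k) (λ j → p j * X j i))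
    ≡⟨ sumFin-+ n (λ i → when (i ≟ i₀) a) (λ i → sumFin (suc k) (λ j → p j * X j i)) ⟩
  sumFin n (λ i → when (i ≟ i₀) a) + sumFin n (λ i → sumFin (suc k) (λ j → p j * X j i))
    ≡⟨ cong₂ _+_ (sumFin-when n i₀ a) (sumFin-comm n (suc k) (λ i j → p j * X j i)) ⟩
  a + sumFin (suc k) (λ j → sumFin n (λ i → p j * X j i))
    ≡⟨ cong (a +_) (sumFin-cong (suc k) (λ j → sumFin-* n (p j) (X j))) ⟩
  a + sumFin (suc k) (λ j → p j * load h (next j) t) ∎
  where
  a : ℚ
  a = h (node r (suc k) p cs) * now t
  X : Fin (suc k) → Fin n → ℚ
  X j i = armSum (setArm c i₀ (just (cs j)) i) (λ sb π → h sb * occ (next j) i π t)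

load-leaf : ∀ {n} {c : Config n} {b r p cs} (h : Tree → ℚ) (i₀ : Fin n)
  (eq : c i₀ ≡ just (node r zero p cs)) (s : Strat (setArm c i₀ nothing) b) t →
  load h (playLeaf i₀ eq s) (suc t) ≡ h (node r zero p cs) * now t + load h s t
load-leaf {n} {c} {r = r} {p} {cs} h i₀ eq s t = begin-equality
  load h (playLeaf i₀ eq s) (suc t)
    ≡⟨ sumFin-cong n (λ i → load-arm-leaf h i₀ eq s i (i ≟ i₀) t) ⟩
  sumFin n (λ i → when (i ≟ i₀) a + Y i)
    ≡⟨ sumFin-+ n (λ i → when (i ≟ i₀) a) Y ⟩
  sumFin n (λ i → when (i ≟ i₀) a) + load h s t
    ≡⟨ cong (_+ load h s t) (sumFin-when n i₀ a) ⟩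
  a + load h s t ∎
  where
  a : ℚ
  a = h (node r zero p cs) * now t
  Y : Fin n → ℚ
  Y i = armSum (setArm c i₀ nothing i) (λ sb π → h sb * occ s i π t)

first-play-≤1 : ∀ t {M : ℕ → ℚ} → M 0 ≡ 0ℚ → (∀ s → M s ≤ 1ℚ) → 1ℚ * now t + M t ≤ 1ℚ
first-play-≤1 zero    {M} M0 M≤1 = Q.≤-reflexive (begin-equality
  1ℚ * 1ℚ + M 0 ≡⟨ cong₂ _+_ (Q.*-identityˡ 1ℚ) M0 ⟩
  1ℚ + 0ℚ       ≡⟨ Q.+-identityʳ 1ℚ ⟩
  1ℚ            ∎)
first-play-≤1 (suc t) {M} M0 M≤1 =
  Q.≤-trans (Q.≤-reflexive (trans (cong (_+ M (suc t)) (Q.*-zeroʳ 1ℚ)) (Q.+-identityˡ _))) (M≤1 (suc t))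

one : Tree → ℚ
one _ = 1ℚ

-- Constraint (3): one play per step, so the total occupation at any time is ≤ 1.
load-≤1 : ∀ {n} {c : Config n} {b} (σ : Strat c b) → WFConfig c → ∀ t → load one σ t ≤ 1ℚ
load-≤1 σ wfc zero = Q.≤-trans (Q.≤-reflexive (load-at-0 one σ)) 0≤1
load-≤1 {c = c} {b} stop wfc (suc t) =
  Q.≤-trans (Q.≤-reflexive (load-null one (stop {c = c} {b}) (suc t) (λ _ _ → refl))) 0≤1
load-≤1 (playNode {k = k} {p = p} i₀ eq next) wfc (suc t) =
  Q.≤-trans (Q.≤-reflexive (load-node one i₀ eq next t))
    (first-play-≤1 t
      (sumFin-zero (suc k) (λ j → trans (cong (p j *_) (load-at-0 one (next j))) (Q.*-zeroʳ (p j))))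
      (λ s → dist-average-≤1 (played-dist wfc eq) (λ j → load-≤1 (next j) (WFConfig-node wfc eq j) s)))
load-≤1 (playLeaf i₀ eq s) wfc (suc t) =
  Q.≤-trans (Q.≤-reflexive (load-leaf one i₀ eq s t))
    (first-play-≤1 t (load-at-0 one s) (load-≤1 s (WFConfig-leaf wfc)))

sumTo-first-play : ∀ a {L M : ℕ → ℚ} → (∀ t → L (suc t) ≡ a * now t + M t) → M 0 ≡ 0ℚ →
  ∀ b → sumTo (suc b) L ≡ a + sumTo b M
sumTo-first-play a {L} {M} L≡ M0 zero = begin-equality
  0ℚ + L 1          ≡⟨ Q.+-identityˡ (L 1) ⟩
  L 1               ≡⟨ L≡ 0 ⟩
  a * 1ℚ + M 0      ≡⟨ cong₂ _+_ (Q.*-identityʳ a) M0 ⟩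
  a + 0ℚ            ∎
sumTo-first-play a {L} {M} L≡ M0 (suc b) = begin-equality
  sumTo (suc b) L + L (suc (suc b))    ≡⟨ cong₂ _+_ (sumTo-first-play a L≡ M0 b) (L≡ (suc b)) ⟩
  (a + sumTo b M) + (a * 0ℚ + M (suc b)) ≡⟨ cong (λ x → (a + sumTo b M) + (x + M (suc b))) (Q.*-zeroʳ a) ⟩
  (a + sumTo b M) + (0ℚ + M (suc b))   ≡⟨ cong ((a + sumTo b M) +_) (Q.+-identityˡ (M (suc b))) ⟩
  (a + sumTo b M) + M (suc b)          ≡⟨ Q.+-assoc a (sumTo b M) (M (suc b)) ⟩
  a + (sumTo b M + M (suc b))          ∎

value≡load : ∀ {n} {c : Config n} {b} (σ : Strat c b) → value σ ≡ sumTo b (load rootReward σ)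
value≡load {c = c} {b} stop =
  sym (sumTo-zero b (λ s → load-null rootReward (stop {c = c} {b}) (suc s) (λ _ _ → refl)))
value≡load {b = suc b} (playNode {r = r} {k = k} {p = p} i₀ eq next) = begin-equality
  r + sumFin (suc k) (λ j → p j * value (next j))
    ≡⟨ cong (r +_) (sumFin-cong (suc k) (λ j → cong (p j *_) (value≡load (next j)))) ⟩
  r + sumFin (suc k) (λ j → p j * sumTo b (load rootReward (next j)))
    ≡⟨ cong (r +_) (sumTo-mix b (suc k) p (λ j → load rootReward (next j))) ⟨
  r + sumTo b (λ s → sumFin (suc k) (λ j → p j * load rootReward (next j) s))
    ≡⟨ sumTo-first-play r (load-node rootReward i₀ eq next)
         (sumFin-zero (suc k) (λ j → trans (cong (p j *_) (load-at-0 rootReward (next j))) (Q.*-zeroʳ (p j)))) b ⟨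
  sumTo (suc b) (load rootReward (playNode i₀ eq next)) ∎
value≡load {b = suc b} (playLeaf {r = r} i₀ eq s) = begin-equality
  r + value s                                     ≡⟨ cong (r +_) (value≡load s) ⟩
  r + sumTo b (load rootReward s)                 ≡⟨ sumTo-first-play r (load-leaf rootReward i₀ eq s) (load-at-0 rootReward s) b ⟨
  sumTo (suc b) (load rootReward (playLeaf i₀ eq s)) ∎

sumTo-load : ∀ {n} {c : Config n} {b} h (σ : Strat c b) t →
  sumTo t (load h σ) ≡ sumFin n (λ i → armSum (c i) (λ sb π → sumTo t (λ s → h sb * occ σ i π s)))
sumTo-load {n} {c} h σ t =
  trans (sumTo-sumFin t n (λ s i → armSum (c i) (λ sb π → h sb * occ σ i π s)))
        (sumFin-cong n (λ i → sym (sumL-sumTo (states (c i)) t (λ (sb , π) s → h sb * occ σ i π s))))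

-- inflow tr x a u: the flow into state u when the root receives a and each
-- state v sends x v * p_{v,v'} to each child v'
inflow : (tr : Tree) → (Pos tr → ℚ) → ℚ → Pos tr → ℚ
inflow tr               x a here       = a
inflow (node r k p cs) x a (into j u) = inflow (cs j) (x ∘ into j) (x here * p j) u

inflow-extend : ∀ tr (x : Pos tr → ℚ) a (v : Pos tr) j → inflow tr x a (extend v j) ≡ x v * prob v j
inflow-extend (node r k p cs) x a here       j  = refl
inflow-extend (node r k p cs) x a (into j v) j′ = inflow-extend (cs j) (x ∘ into j) (x here * p j) v j′

inflow-InUnit : ∀ tr → WF tr → {x : Pos tr → ℚ} → (∀ u → InUnit (x u)) → ∀ {a} → InUnit a →
  ∀ u → InUnit (inflow tr x a u)
inflow-InUnit tr                     wf x∈ a∈ here       = a∈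
inflow-InUnit (node r zero p cs)     wf x∈ a∈ (into () u)
inflow-InUnit (node r (suc k) p cs) wf x∈ a∈ (into j u) =
  inflow-InUnit (cs j) (proj₂ (proj₂ wf) j) (x∈ ∘ into j)
    (InUnit-* (x∈ here) (dist-InUnit (node-dist {r} {k} {p} {cs} wf) j)) u

-- The LP variables w built from z: all ones at time 1 (where constraint (1)
-- does not apply), inflows of z at later times.
inflowVars : ∀ {n} (T : Fin n → Tree) → Vars T → Vars T
inflowVars T z i u zero          = 0ℚ
inflowVars T z i u (suc zero)    = 1ℚ
inflowVars T z i u (suc (suc t)) = inflow (T i) (λ v → z i v (suc t)) 0ℚ u

inflowVars-InUnit : ∀ {n} (T : Fin n → Tree) → (∀ i → WF (T i)) → (z : Vars T) →
  (∀ i u t → InUnit (z i u t)) → ∀ i u t → InUnit (inflowVars T z i u t)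
inflowVars-InUnit T wf z z∈ i u zero          = Q.≤-refl , 0≤1
inflowVars-InUnit T wf z z∈ i u (suc zero)    = 0≤1 , Q.≤-refl
inflowVars-InUnit T wf z z∈ i u (suc (suc t)) =
  inflow-InUnit (T i) (wf i) (λ v → z∈ i v (suc t)) (Q.≤-refl , 0≤1) u

-- Constraint (2): at time 1 the inflow is 1, which dominates any cumulative
-- occupation bounded by 1.
inflowVars-cumulative : ∀ {n} (T : Fin n → Tree) → (∀ i → WF (T i)) → (z : Vars T) →
  (∀ i u t → InUnit (z i u t)) → (∀ i u t → sumTo t (z i u) ≤ 1ℚ) →
  ∀ i u t → 1 ℕ.≤ t → sumTo t (z i u) ≤ sumTo t (inflowVars T z i u)
inflowVars-cumulative T wf z z∈ Σz≤1 i u (suc t) _ = Q.≤-trans (Σz≤1 i u (suc t))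
  (sumTo-first t (λ s → proj₁ (inflowVars-InUnit T wf z z∈ i u (suc (suc s)))))

inflowVars-parent : ∀ {n} (T : Fin n → Tree) (z : Vars T) i (v : Pos (T i)) j t → 2 ℕ.≤ t →
  inflowVars T z i (extend v j) t ≡ z i v (t ∸ 1) * prob v j
inflowVars-parent T z i v j (suc zero)    (s≤s ())
inflowVars-parent T z i v j (suc (suc t)) _ = inflow-extend (T i) (λ v → z i v (suc t)) 0ℚ v j

occVars : ∀ {n} (T : Fin n → Tree) {b} → Strat (initConfig T) b → Vars T
occVars T σ i u t = occ σ i (address u) t

occVars-total : ∀ {n} (T : Fin n → Tree) {b} (σ : Strat (initConfig T) b) t →
  sumStates T (λ i u → occVars T σ i u t) ≡ load one σ t
occVars-total {n} T σ t = sumFin-cong n (λ i → trans (sym (armSum-just (T i) (λ _ π → occ σ i π t)))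
  (sumL-cong (states (just (T i))) (λ (_ , π) → sym (Q.*-identityˡ (occ σ i π t)))))

occVars-objective : ∀ {n} (T : Fin n → Tree) {B} (σ : Strat (initConfig T) B) →
  sumTo B (load rootReward σ) ≡ objective T B (occVars T σ)
occVars-objective {n} T {B} σ = trans (sumTo-load rootReward σ B)
  (sumFin-cong n (λ i → armSum-just (T i) (λ sb π → sumTo B (λ t → rootReward sb * occ σ i π t))))

mainTheorem1 : (n : ℕ) (T : Fin n → Tree) → ((i : Fin n) → WF (T i)) →
    (B : ℕ) (σ : Strat (initConfig T) B) →
    Σ (Vars T) λ z → Σ (Vars T) λ w →
    LPFeasible T B z w × (value σ ≤ objective T B z)
mainTheorem1 n T wf B σ =
  z , w , feasible , Q.≤-reflexive (trans (value≡load σ) (occVars-objective T σ))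
  where
  wfc : WFConfig (initConfig T)
  wfc i tr e = subst WF (just-injective e) (wf i)
  z w : Vars T
  z = occVars T σ
  w = inflowVars T z
  z∈ : ∀ i u t → InUnit (z i u t)
  z∈ i u = occ-InUnit σ wfc i (address u)
  feasible : LPFeasible T B z w
  feasible = record
    { z-range = λ i u t _ _ → z∈ i u t
    ; w-range = λ i u t _ _ → inflowVars-InUnit T wf z z∈ i u t
    ; c1 = λ i v j t 2≤t _ → inflowVars-parent T z i v j t 2≤t
    ; c2 = λ i u t 1≤t _ → inflowVars-cumulative T wf z z∈
             (λ i u → occ-cumulative-≤1 σ wfc i (address u)) i u t 1≤t
    ; c3 = λ t _ _ → Q.≤-trans (Q.≤-reflexive (occVars-total T σ t)) (load-≤1 σ wfc t)
    ; c4 = λ i → refl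
    }
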